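{- Let $A$ be a commutative ring, $a\in A$ a nonzerodivisor, and suppose $A$ is $a$-adically complete; filter $A$ by $F^iA=a^iA$. Let $M$ be a finite free $A$-module and $N\subset M[1/a]$ a finitely generated $A$-submodule with $N[1/a]=M[1/a]$, filtered by $F^iN=a^iM\cap N$ ($i\in\mathbb{Z}$). Give $N/aN$ the quotient filtration. Suppose $(g_i)$ is a finite collection of elements of $N$ and $(r_i)$ integers with $g_i\in F^{r_i}N$, such that the images of the $g_i$ in $\operatorname{gr}^{r_i}(N/aN)$ form an $A/a$-basis of $\operatorname{gr}(N/aN)=\bigoplus_j\operatorname{gr}^j(N/aN)$. Then $(g_i)$ is an $A$-basis of $N$ and $(a^{ -r_i}g_i)$ is an $A$-basis of $M$.
   Context: For a filtered module $X$ (decreasing filtration $F^iX$), $\operatorname{gr}^j(X)=F^jX/F^{j+1}X$. The quotient filtration on $N/aN$ is $F^j(N/aN)=$ image of $F^jN$. -}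

module Defs where

open import Level using (_⊔_)
open import Algebra.Bundles using (CommutativeRing)
open import Data.Nat using (ℕ; zero; suc; _<_) renaming (_+_ to _+ℕ_)
open import Data.Integer using (ℤ; +_; -[1+_]; ∣_∣; _≟_) renaming (suc to sucℤ)
open import Data.Fin using (Fin) renaming (zero to fzero; suc to fsuc)
open import Data.Product using (Σ; ∃; _×_; _,_; proj₁; proj₂)
open import Data.Bool using (if_then_else_)
open import Relation.Nullary.Decidable using (⌊_⌋)

module Ctx {c ℓ} (R : CommutativeRing c ℓ) (n : ℕ) (a : CommutativeRing.Carrier R) where
  open CommutativeRing R

  pow : Carrier → ℕ → Carrier
  pow x zero = 1#
  pow x (suc k) = x * pow x k

  _∣A_ : Carrier → Carrier → Set (c ⊔ ℓ)
  d ∣A y = Σ Carrier λ z → y ≈ d * z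

  NonZeroDivisor : Set (c ⊔ ℓ)
  NonZeroDivisor = ∀ x → a * x ≈ 0# → x ≈ 0#

  -- a-adically separated and complete: A → lim A/a^k A is bijective
  Separated : Set (c ⊔ ℓ)
  Separated = ∀ x → (∀ k → pow a k ∣A x) → x ≈ 0#

  Complete : Set (c ⊔ ℓ)
  Complete = ∀ (x : ℕ → Carrier) → (∀ k → pow a k ∣A (x (suc k) - x k)) →
             Σ Carrier λ y → ∀ k → pow a k ∣A (y - x k)

  AdicallyComplete : Set (c ⊔ ℓ)
  AdicallyComplete = Separated × Complete

  M : Set c
  M = Fin n → Carrier

  _·M_ : Carrier → M → M
  (x ·M m) t = x * m t

  _+M_ : M → M → M
  (m +M m') t = m t + m' t

  0M : M
  0M t = 0#

  -- M[1/a]: a pair (k , m) represents a^{-k} m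
  Loc : Set c
  Loc = ℕ × M

  _≈L_ : Loc → Loc → Set ℓ
  (k , m) ≈L (k' , m') = ∀ t → pow a k' * m t ≈ pow a k * m' t

  _+L_ : Loc → Loc → Loc
  (k , m) +L (k' , m') = (k +ℕ k') , ((pow a k' ·M m) +M (pow a k ·M m'))

  _·L_ : Carrier → Loc → Loc
  x ·L (k , m) = k , (x ·M m)

  0L : Loc
  0L = 0 , 0M

  -L_ : Loc → Loc
  -L x = (- 1#) ·L x

  _-L_ : Loc → Loc → Loc
  x -L y = x +L (-L y)

  ιM : M → Loc
  ιM m = 0 , m

  aPowZ : ℤ → M → Loc
  aPowZ (+ k) m = 0 , (pow a k ·M m)
  aPowZ -[1+ k ] m = suc k , m

  -- a^{-j} x for j ∈ ℤ, x ∈ M[1/a]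
  shift : ℤ → Loc → Loc
  shift (+ j) (k , m) = (k +ℕ j) , m
  shift -[1+ j ] (k , m) = k , (pow a (suc j) ·M m)

  sumL : ∀ {s} → (Fin s → Loc) → Loc
  sumL {zero} f = 0L
  sumL {suc s} f = f fzero +L sumL (λ t → f (fsuc t))

  comb : ∀ {s} → (Fin s → Carrier) → (Fin s → Loc) → Loc
  comb c g = sumL (λ i → c i ·L g i)

  InaM : ℤ → Loc → Set (c ⊔ ℓ)
  InaM j x = Σ M λ m → x ≈L aPowZ j m

  InM : Loc → Set (c ⊔ ℓ)
  InM x = Σ M λ m → x ≈L ιM m

  -- the A-submodule N ⊆ M[1/a] generated by h_1, …, h_s
  module Sub {s : ℕ} (h : Fin s → Loc) where

    InN : Loc → Set (c ⊔ ℓ)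
    InN x = Σ (Fin s → Carrier) λ d → x ≈L comb d h

    -- N[1/a] = M[1/a]  (⊆ is automatic)
    LocalizesToAll : Set (c ⊔ ℓ)
    LocalizesToAll = ∀ x → Σ ℕ λ k → InN (pow a k ·L x)

    InFN : ℤ → Loc → Set (c ⊔ ℓ)
    InFN j x = InaM j x × InN x

    -- F^j N + aN  (the preimage in N of F^j(N/aN), quotient filtration)
    InFN+aN : ℤ → Loc → Set (c ⊔ ℓ)
    InFN+aN j x = Σ Loc λ y → Σ Loc λ z → InFN j y × InN z × (x ≈L (y +L (a ·L z)))

    -- gr(N/aN) = ⊕_j gr^j(N/aN), gr^j(N/aN) = F^j(N/aN)/F^{j+1}(N/aN)
    --          = (F^j N + aN)/(F^{j+1} N + aN).
    -- An element is represented by a family x_j ∈ F^j N (j ∈ ℤ) whose classes vanish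
    -- for |j| large; two such families are equal iff equal in every gr^j.
    IsGrElt : (ℤ → Loc) → Set (c ⊔ ℓ)
    IsGrElt x = (∀ j → InFN j (x j)) ×
                Σ ℕ (λ B → ∀ j → B < ∣ j ∣ → InFN+aN (sucℤ j) (x j))

    _≈gr_ : (ℤ → Loc) → (ℤ → Loc) → Set (c ⊔ ℓ)
    x ≈gr y = ∀ j → InFN+aN (sucℤ j) (x j -L y j)

    -- Σ_i c̄_i ḡ_i ∈ gr(N/aN), with ḡ_i the image of g_i in gr^{r_i}, c̄_i ∈ A/a
    -- represented by lifts c_i ∈ A.
    grComb : ∀ {m} → (Fin m → Carrier) → (Fin m → Loc) → (Fin m → ℤ) → (ℤ → Loc)
    grComb c g r j = comb (λ i → if ⌊ r i ≟ j ⌋ then c i else 0#) g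

    zeroGr : ℤ → Loc
    zeroGr j = 0L

    IsGrBasis : ∀ {m} → (Fin m → Loc) → (Fin m → ℤ) → Set (c ⊔ ℓ)
    IsGrBasis g r =
      (∀ x → IsGrElt x → Σ (Fin _ → Carrier) λ c → x ≈gr grComb c g r) ×
      (∀ c → grComb c g r ≈gr zeroGr → ∀ i → a ∣A c i)

    IsNBasis : ∀ {m} → (Fin m → Loc) → Set (c ⊔ ℓ)
    IsNBasis g =
      (∀ i → InN (g i)) ×
      (∀ x → InN x → Σ (Fin _ → Carrier) λ c → x ≈L comb c g) ×
      (∀ c → comb c g ≈L 0L → ∀ i → c i ≈ 0#)

  IsMBasis : ∀ {m} → (Fin m → Loc) → Set (c ⊔ ℓ)
  IsMBasis e =
    (∀ i → InM (e i)) ×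
    (∀ x → InM x → Σ (Fin _ → Carrier) λ c → x ≈L comb c e) ×
    (∀ c → comb c e ≈L 0L → ∀ i → c i ≈ 0#)

-- Write e_i = a^(-r_i) g_i and let S bound all |r_i|.  Independence: if Σ c_i g_i lies
-- in F^j N, the independence of the images in gr(N/aN), applied level by level from the
-- bottom, shows that a divides c_i whenever r_i < j; dividing those c_i by a lands one
-- level lower, so a^k | c_i whenever r_i + k ≤ j, and a relation Σ c_i g_i = 0 forces
-- every c_i to be divisible by all powers of a, hence zero by separatedness.
-- Spanning: N is finitely generated, so N ⊆ a^(-B) M, and a^K M ⊆ N because N[1/a] = M[1/a],
-- so F^(K+1) N ⊆ aN.  Climbing from level -B to K+1 with the spanning of gr(N/aN) writes
-- every x in N as Σ c_i g_i + a w with w in N; iterating gives partial sums that converge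
-- a-adically, and the limit agrees with x modulo a^k N for every k, hence equals x.
-- Multiplying by a^S turns both statements about the e_i into statements about the g_i.

module Submission where

open import Defs
open import Level using (_⊔_)
open import Algebra.Bundles using (CommutativeRing; CommutativeMonoid)
import Algebra.Properties.CommutativeSemigroup as CommutativeSemigroupProperties
open import Data.Nat using (ℕ; zero; suc; _∸_) renaming (_+_ to _+ℕ_; _≤_ to _≤ℕ_; _<_ to _<ℕ_)
import Data.Nat.Properties as ℕ
open import Data.Integer using (ℤ; +_; -[1+_]; ∣_∣; _≟_; _<?_) renaming (suc to sucℤ)
import Data.Integer as ℤ
import Data.Integer.Properties as ℤ
open import Data.Integer.Tactic.RingSolver using (solve-∀)
open import Data.Fin using (Fin) renaming (zero to fzero; suc to fsuc)
open import Data.Product using (_×_; _,_; Σ; proj₁; proj₂)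
open import Data.Bool using (if_then_else_)
open import Data.Maybe using (nothing)
open import Data.Empty using (⊥-elim)
open import Relation.Nullary using (¬_; yes; no)
open import Relation.Nullary.Decidable using (⌊_⌋)
open import Relation.Unary using (Decidable)
open import Relation.Unary.Properties using (∁?)
open import Relation.Binary.Bundles using (Setoid)
import Relation.Binary.Reasoning.Setoid as SetoidReasoning
open import Relation.Binary.PropositionalEquality as ≡ using (_≡_; subst; cong)

≤⇒≡+ : ∀ {i j} → i ℤ.≤ j → Σ ℕ λ k → j ≡ i ℤ.+ + k
≤⇒≡+ {i} {j} i≤j = ∣ i ℤ.- j ∣ , ≡.sym (≡.trans (cong (λ w → i ℤ.+ w) (ℤ.∣-∣-≤ i≤j)) (cancel i j))
  where
  cancel : ∀ i j → i ℤ.+ (j ℤ.- i) ≡ j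
  cancel = solve-∀

i+[1+j]≡1+[i+j] : ∀ i j → i ℤ.+ (ℤ.1ℤ ℤ.+ j) ≡ ℤ.1ℤ ℤ.+ (i ℤ.+ j)
i+[1+j]≡1+[i+j] = solve-∀

∑ℕ : ∀ {k} → (Fin k → ℕ) → ℕ
∑ℕ {zero} f = 0
∑ℕ {suc k} f = f fzero +ℕ ∑ℕ (λ i → f (fsuc i))

≤∑ℕ : ∀ {k} (f : Fin k → ℕ) i → f i ≤ℕ ∑ℕ f
≤∑ℕ f fzero = ℕ.m≤m+n _ _
≤∑ℕ f (fsuc i) = ℕ.≤-trans (≤∑ℕ (λ i → f (fsuc i)) i) (ℕ.m≤n+m _ _)

-∣i∣≤i : ∀ i → ℤ.- (+ ∣ i ∣) ℤ.≤ i
-∣i∣≤i (+ k) = ℤ.neg-≤-pos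
-∣i∣≤i -[1+ k ] = ℤ.≤-refl

i+[1+j]≡[1+i]+j : ∀ i j → i ℤ.+ (ℤ.1ℤ ℤ.+ j) ≡ (ℤ.1ℤ ℤ.+ i) ℤ.+ j
i+[1+j]≡[1+i]+j = solve-∀

<suc⇒≤ : ∀ {i j} → i ℤ.< sucℤ j → i ℤ.≤ j
<suc⇒≤ {i} {j} i<1+j = subst (i ℤ.≤_) (ℤ.pred-suc j) (ℤ.i<j⇒i≤pred[j] i<1+j)

module Localisation {c ℓ} (R : CommutativeRing c ℓ) (n : ℕ) (a : CommutativeRing.Carrier R)
                    (a-nonZeroDivisor : Ctx.NonZeroDivisor R n a) where
  open CommutativeRing R
  open Ctx R n a
  open import Algebra.Solver.Ring.NaturalCoefficients commutativeSemiring (λ _ _ → nothing)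
    using (solve; _:+_; _:*_; _:=_)
  open import Algebra.Properties.Ring ring using (-‿distribʳ-*)
  open import Algebra.Properties.Group +-group using (x∙y⁻¹≈ε⇒x≈y)
  open import Algebra.Properties.Semiring.Sum semiring using (sum; *-distribʳ-sum)
  module ≈-Reasoning = SetoidReasoning setoid

  pow-+ : ∀ k l → pow a (k +ℕ l) ≈ pow a k * pow a l
  pow-+ zero l = sym (*-identityˡ _)
  pow-+ (suc k) l = trans (*-congˡ (pow-+ k l)) (sym (*-assoc _ _ _))

  pow-nonZeroDivisor : ∀ k x → pow a k * x ≈ 0# → x ≈ 0#
  pow-nonZeroDivisor zero x p = trans (sym (*-identityˡ x)) p
  pow-nonZeroDivisor (suc k) x p =
    pow-nonZeroDivisor k x (a-nonZeroDivisor _ (trans (sym (*-assoc _ _ _)) p))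

  pow-cancelˡ : ∀ k {x y} → pow a k * x ≈ pow a k * y → x ≈ y
  pow-cancelˡ k {x} {y} p = x∙y⁻¹≈ε⇒x≈y x y (pow-nonZeroDivisor k _ (begin
    pow a k * (x - y)              ≈⟨ distribˡ _ _ _ ⟩
    pow a k * x + pow a k * (- y)  ≈⟨ +-congˡ (sym (-‿distribʳ-* _ _)) ⟩
    pow a k * x - pow a k * y      ≈⟨ +-congʳ p ⟩
    pow a k * y - pow a k * y      ≈⟨ -‿inverseʳ _ ⟩
    0#                             ∎))
    where open ≈-Reasoning

  *-swapˡ : ∀ x y z → x * (y * z) ≈ y * (x * z)
  *-swapˡ = solve 3 (λ x y z → x :* (y :* z) := y :* (x :* z)) refl

  -- A wrapper around _≈L_, which is defined by matching on pairs and so does not let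
  -- Agda infer its arguments.  It is transitive only because a is a nonzerodivisor.
  infix 4 _≃_
  record _≃_ (x y : Loc) : Set ℓ where
    constructor ≈L⇒≃
    field ≃⇒≈L : x ≈L y
  open _≃_ public

  ≃-refl : ∀ {x} → x ≃ x
  ≃-refl = ≈L⇒≃ (λ t → refl)

  ≃-sym : ∀ {x y} → x ≃ y → y ≃ x
  ≃-sym (≈L⇒≃ p) = ≈L⇒≃ (λ t → sym (p t))

  ≃-trans : ∀ {x y z} → x ≃ y → y ≃ z → x ≃ z
  ≃-trans {k , m} {k' , m'} {k'' , m''} (≈L⇒≃ p) (≈L⇒≃ q) = ≈L⇒≃ λ t → pow-cancelˡ k' (begin
    pow a k' * (pow a k'' * m t)   ≈⟨ *-swapˡ _ _ _ ⟩
    pow a k'' * (pow a k' * m t)   ≈⟨ *-congˡ (p t) ⟩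
    pow a k'' * (pow a k * m' t)   ≈⟨ *-swapˡ _ _ _ ⟩
    pow a k * (pow a k'' * m' t)   ≈⟨ *-congˡ (q t) ⟩
    pow a k * (pow a k' * m'' t)   ≈⟨ *-swapˡ _ _ _ ⟩
    pow a k' * (pow a k * m'' t)   ∎)
    where open ≈-Reasoning

  ≃-setoid : Setoid c ℓ
  ≃-setoid = record
    { Carrier = Loc ; _≈_ = _≃_
    ; isEquivalence = record { refl = ≃-refl ; sym = ≃-sym ; trans = ≃-trans } }

  module ≃-Reasoning = SetoidReasoning ≃-setoid

  +L-cong : ∀ {x x' y y'} → x ≃ x' → y ≃ y' → x +L y ≃ x' +L y'
  +L-cong {k₁ , m₁} {k₁' , m₁'} {k₂ , m₂} {k₂' , m₂'} (≈L⇒≃ p) (≈L⇒≃ q) = ≈L⇒≃ λ t → begin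
    pow a (k₁' +ℕ k₂') * (pow a k₂ * m₁ t + pow a k₁ * m₂ t)
      ≈⟨ *-congʳ (pow-+ k₁' k₂') ⟩
    (pow a k₁' * pow a k₂') * (pow a k₂ * m₁ t + pow a k₁ * m₂ t)
      ≈⟨ expand _ _ _ _ _ _ ⟩
    (pow a k₂' * pow a k₂) * (pow a k₁' * m₁ t) + (pow a k₁' * pow a k₁) * (pow a k₂' * m₂ t)
      ≈⟨ +-cong (*-congˡ (p t)) (*-congˡ (q t)) ⟩
    (pow a k₂' * pow a k₂) * (pow a k₁ * m₁' t) + (pow a k₁' * pow a k₁) * (pow a k₂ * m₂' t)
      ≈⟨ collect _ _ _ _ _ _ ⟩
    (pow a k₁ * pow a k₂) * (pow a k₂' * m₁' t + pow a k₁' * m₂' t)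
      ≈⟨ *-congʳ (sym (pow-+ k₁ k₂)) ⟩
    pow a (k₁ +ℕ k₂) * (pow a k₂' * m₁' t + pow a k₁' * m₂' t)
      ∎
    where
    open ≈-Reasoning
    expand : ∀ A₁ A₁' A₂ A₂' x y →
             (A₁' * A₂') * (A₂ * x + A₁ * y) ≈ (A₂' * A₂) * (A₁' * x) + (A₁' * A₁) * (A₂' * y)
    expand = solve 6 (λ A₁ A₁' A₂ A₂' x y →
      (A₁' :* A₂') :* (A₂ :* x :+ A₁ :* y) := (A₂' :* A₂) :* (A₁' :* x) :+ (A₁' :* A₁) :* (A₂' :* y)) refl
    collect : ∀ A₁ A₁' A₂ A₂' x y →
              (A₂' * A₂) * (A₁ * x) + (A₁' * A₁) * (A₂ * y) ≈ (A₁ * A₂) * (A₂' * x + A₁' * y)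
    collect = solve 6 (λ A₁ A₁' A₂ A₂' x y →
      (A₂' :* A₂) :* (A₁ :* x) :+ (A₁' :* A₁) :* (A₂ :* y) := (A₁ :* A₂) :* (A₂' :* x :+ A₁' :* y)) refl

  +L-comm : ∀ x y → x +L y ≃ y +L x
  +L-comm (k₁ , m₁) (k₂ , m₂) = ≈L⇒≃ λ t → begin
    pow a (k₂ +ℕ k₁) * (pow a k₂ * m₁ t + pow a k₁ * m₂ t)        ≈⟨ *-congʳ (pow-+ k₂ k₁) ⟩
    (pow a k₂ * pow a k₁) * (pow a k₂ * m₁ t + pow a k₁ * m₂ t)   ≈⟨ swap _ _ _ _ ⟩
    (pow a k₁ * pow a k₂) * (pow a k₁ * m₂ t + pow a k₂ * m₁ t)   ≈⟨ *-congʳ (sym (pow-+ k₁ k₂)) ⟩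
    pow a (k₁ +ℕ k₂) * (pow a k₁ * m₂ t + pow a k₂ * m₁ t)        ∎
    where
    open ≈-Reasoning
    swap : ∀ A₁ A₂ x y → (A₂ * A₁) * (A₂ * x + A₁ * y) ≈ (A₁ * A₂) * (A₁ * y + A₂ * x)
    swap = solve 4 (λ A₁ A₂ x y → (A₂ :* A₁) :* (A₂ :* x :+ A₁ :* y) := (A₁ :* A₂) :* (A₁ :* y :+ A₂ :* x)) refl

  +L-assoc : ∀ x y z → (x +L y) +L z ≃ x +L (y +L z)
  +L-assoc (k₁ , m₁) (k₂ , m₂) (k₃ , m₃) = ≈L⇒≃ λ t → begin
    pow a (k₁ +ℕ (k₂ +ℕ k₃)) * (pow a k₃ * (pow a k₂ * m₁ t + pow a k₁ * m₂ t) + pow a (k₁ +ℕ k₂) * m₃ t)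
      ≈⟨ *-cong (trans (pow-+ k₁ _) (*-congˡ (pow-+ k₂ k₃))) (+-congˡ (*-congʳ (pow-+ k₁ k₂))) ⟩
    (A₁ * (A₂ * A₃)) * (A₃ * (A₂ * m₁ t + A₁ * m₂ t) + (A₁ * A₂) * m₃ t)
      ≈⟨ reassoc A₁ A₂ A₃ (m₁ t) (m₂ t) (m₃ t) ⟩
    ((A₁ * A₂) * A₃) * ((A₂ * A₃) * m₁ t + A₁ * (A₃ * m₂ t + A₂ * m₃ t))
      ≈⟨ sym (*-cong (trans (pow-+ (k₁ +ℕ k₂) k₃) (*-congʳ (pow-+ k₁ k₂))) (+-congʳ (*-congʳ (pow-+ k₂ k₃)))) ⟩
    pow a ((k₁ +ℕ k₂) +ℕ k₃) * (pow a (k₂ +ℕ k₃) * m₁ t + pow a k₁ * (pow a k₃ * m₂ t + pow a k₂ * m₃ t))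
      ∎
    where
    open ≈-Reasoning
    A₁ = pow a k₁
    A₂ = pow a k₂
    A₃ = pow a k₃
    reassoc : ∀ A₁ A₂ A₃ x y z → (A₁ * (A₂ * A₃)) * (A₃ * (A₂ * x + A₁ * y) + (A₁ * A₂) * z)
                                ≈ ((A₁ * A₂) * A₃) * ((A₂ * A₃) * x + A₁ * (A₃ * y + A₂ * z))
    reassoc = solve 6 (λ A₁ A₂ A₃ x y z →
      (A₁ :* (A₂ :* A₃)) :* (A₃ :* (A₂ :* x :+ A₁ :* y) :+ (A₁ :* A₂) :* z)
      := ((A₁ :* A₂) :* A₃) :* ((A₂ :* A₃) :* x :+ A₁ :* (A₃ :* y :+ A₂ :* z))) refl

  +L-identityˡ : ∀ x → 0L +L x ≃ x
  +L-identityˡ (k , m) = ≈L⇒≃ λ t → *-congˡ (trans (+-cong (zeroʳ _) (*-identityˡ _)) (+-identityˡ _))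

  +L-congˡ : ∀ x {y y'} → y ≃ y' → x +L y ≃ x +L y'
  +L-congˡ x = +L-cong (≃-refl {x})

  +L-congʳ : ∀ {x x'} y → x ≃ x' → x +L y ≃ x' +L y
  +L-congʳ y x≃x' = +L-cong x≃x' (≃-refl {y})

  +L-commutativeMonoid : CommutativeMonoid c ℓ
  +L-commutativeMonoid = record
    { Carrier = Loc ; _≈_ = _≃_ ; _∙_ = _+L_ ; ε = 0L
    ; isCommutativeMonoid = record
      { isMonoid = record
        { isSemigroup = record
          { isMagma = record { isEquivalence = Setoid.isEquivalence ≃-setoid ; ∙-cong = +L-cong }
          ; assoc = +L-assoc }
        ; identity = +L-identityˡ , λ x → ≃-trans (+L-comm x 0L) (+L-identityˡ x) }
      ; comm = +L-comm } }

  open CommutativeMonoid +L-commutativeMonoid public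
    using () renaming (identityʳ to +L-identityʳ)
  open CommutativeSemigroupProperties (CommutativeMonoid.commutativeSemigroup +L-commutativeMonoid) public
    using () renaming (interchange to +L-interchange)

  ·L-cong : ∀ {x y u v} → x ≈ y → u ≃ v → x ·L u ≃ y ·L v
  ·L-cong {x} {y} {k , m} {k' , m'} x≈y (≈L⇒≃ p) = ≈L⇒≃ λ t → begin
    pow a k' * (x * m t)   ≈⟨ *-swapˡ _ _ _ ⟩
    x * (pow a k' * m t)   ≈⟨ *-cong x≈y (p t) ⟩
    y * (pow a k * m' t)   ≈⟨ *-swapˡ _ _ _ ⟩
    pow a k * (y * m' t)   ∎
    where open ≈-Reasoning

  ·L-congˡ : ∀ x {u v} → u ≃ v → x ·L u ≃ x ·L v
  ·L-congˡ x = ·L-cong refl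

  ·L-distribˡ : ∀ x u v → x ·L (u +L v) ≃ (x ·L u) +L (x ·L v)
  ·L-distribˡ x (k₁ , m₁) (k₂ , m₂) = ≈L⇒≃ λ t → *-congˡ (expand (pow a k₁) (pow a k₂) (m₁ t) (m₂ t))
    where
    expand : ∀ A₁ A₂ y z → x * (A₂ * y + A₁ * z) ≈ A₂ * (x * y) + A₁ * (x * z)
    expand = solve 5 (λ x A₁ A₂ y z → x :* (A₂ :* y :+ A₁ :* z) := A₂ :* (x :* y) :+ A₁ :* (x :* z)) refl x

  ·L-distribʳ : ∀ x y u → (x + y) ·L u ≃ (x ·L u) +L (y ·L u)
  ·L-distribʳ x y (k , m) = ≈L⇒≃ λ t → trans (*-congʳ (pow-+ k k)) (expand (pow a k) (m t))
    where
    expand : ∀ A z → (A * A) * ((x + y) * z) ≈ A * (A * (x * z) + A * (y * z))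
    expand = solve 4 (λ x y A z → (A :* A) :* ((x :+ y) :* z) := A :* (A :* (x :* z) :+ A :* (y :* z))) refl x y

  ·L-assoc : ∀ x y u → (x * y) ·L u ≃ x ·L (y ·L u)
  ·L-assoc x y (k , m) = ≈L⇒≃ λ t → *-congˡ (*-assoc x y (m t))

  ·L-comm : ∀ x y u → x ·L (y ·L u) ≃ y ·L (x ·L u)
  ·L-comm x y (k , m) = ≈L⇒≃ λ t → *-congˡ (*-swapˡ x y (m t))

  ·L-identity : ∀ u → 1# ·L u ≃ u
  ·L-identity (k , m) = ≈L⇒≃ λ t → *-congˡ (*-identityˡ _)

  ·L-zeroˡ : ∀ u → 0# ·L u ≃ 0L
  ·L-zeroˡ (k , m) = ≈L⇒≃ λ t → trans (trans (*-identityˡ _) (zeroˡ _)) (sym (zeroʳ _))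

  ·L-zeroʳ : ∀ x → x ·L 0L ≃ 0L
  ·L-zeroʳ x = ≈L⇒≃ λ t → *-congˡ (zeroʳ x)

  -L-inverseʳ : ∀ x → x -L x ≃ 0L
  -L-inverseʳ x = begin
    x +L ((- 1#) ·L x)         ≈⟨ +L-congʳ ((- 1#) ·L x) (≃-sym (·L-identity x)) ⟩
    (1# ·L x) +L ((- 1#) ·L x) ≈⟨ ≃-sym (·L-distribʳ 1# (- 1#) x) ⟩
    (1# - 1#) ·L x             ≈⟨ ·L-cong (-‿inverseʳ 1#) ≃-refl ⟩
    0# ·L x                    ≈⟨ ·L-zeroˡ x ⟩
    0L                         ∎
    where open ≃-Reasoning

  -L-identityʳ : ∀ x → x -L 0L ≃ x
  -L-identityʳ x = ≃-trans (+L-congˡ x (·L-zeroʳ (- 1#))) (+L-identityʳ x)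

  +L--L-cancelʳ : ∀ x y → (x +L y) -L y ≃ x
  +L--L-cancelʳ x y = begin
    (x +L y) +L ((- 1#) ·L y)   ≈⟨ +L-assoc x y _ ⟩
    x +L (y -L y)               ≈⟨ +L-congˡ x (-L-inverseʳ y) ⟩
    x +L 0L                     ≈⟨ +L-identityʳ x ⟩
    x                           ∎
    where open ≃-Reasoning

  -L-+L-cancelʳ : ∀ x y → (x -L y) +L y ≃ x
  -L-+L-cancelʳ x y = begin
    (x +L ((- 1#) ·L y)) +L y   ≈⟨ +L-assoc x _ y ⟩
    x +L (((- 1#) ·L y) +L y)   ≈⟨ +L-congˡ x (≃-trans (+L-comm _ y) (-L-inverseʳ y)) ⟩
    x +L 0L                     ≈⟨ +L-identityʳ x ⟩
    x                           ∎
    where open ≃-Reasoning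

  ≃+L⇒-L≃ : ∀ {x y z} → x ≃ y +L z → x -L y ≃ z
  ≃+L⇒-L≃ {x} {y} {z} x≃y+z = begin
    x -L y            ≈⟨ +L-congʳ ((- 1#) ·L y) (≃-trans x≃y+z (+L-comm y z)) ⟩
    (z +L y) -L y     ≈⟨ +L--L-cancelʳ z y ⟩
    z                 ∎
    where open ≃-Reasoning

  -L≃0⇒≃ : ∀ {x y} → x -L y ≃ 0L → x ≃ y
  -L≃0⇒≃ {x} {y} x-y≃0 = begin
    x                 ≈⟨ -L-+L-cancelʳ x y ⟨
    (x -L y) +L y     ≈⟨ +L-congʳ y x-y≃0 ⟩
    0L +L y           ≈⟨ +L-identityˡ y ⟩
    y                 ∎
    where open ≃-Reasoning

  ·L-cancel-pow : ∀ k {u v} → pow a k ·L u ≃ pow a k ·L v → u ≃ v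
  ·L-cancel-pow k {l , m} {l' , m'} (≈L⇒≃ p) = ≈L⇒≃ λ t →
    pow-cancelˡ k (trans (*-swapˡ _ _ _) (trans (p t) (*-swapˡ _ _ _)))

  sumL-cong : ∀ {s} {f f' : Fin s → Loc} → (∀ i → f i ≃ f' i) → sumL f ≃ sumL f'
  sumL-cong {zero} p = ≃-refl
  sumL-cong {suc s} p = +L-cong (p fzero) (sumL-cong (λ i → p (fsuc i)))

  sumL-+ : ∀ {s} (f f' : Fin s → Loc) → sumL (λ i → f i +L f' i) ≃ sumL f +L sumL f'
  sumL-+ {zero} f f' = ≃-sym (+L-identityˡ 0L)
  sumL-+ {suc s} f f' = ≃-trans (+L-congˡ (f fzero +L f' fzero) (sumL-+ (λ i → f (fsuc i)) (λ i → f' (fsuc i))))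
                                (+L-interchange (f fzero) (f' fzero) _ _)

  ·L-sumL : ∀ {s} x (f : Fin s → Loc) → x ·L sumL f ≃ sumL (λ i → x ·L f i)
  ·L-sumL {zero} x f = ·L-zeroʳ x
  ·L-sumL {suc s} x f = ≃-trans (·L-distribˡ x (f fzero) _) (+L-congˡ (x ·L f fzero) (·L-sumL x (λ i → f (fsuc i))))

  comb-cong : ∀ {s} {c c' : Fin s → Carrier} v → (∀ i → c i ≈ c' i) → comb c v ≃ comb c' v
  comb-cong v c≈c' = sumL-cong (λ i → ·L-cong (c≈c' i) ≃-refl)

  comb-+ : ∀ {s} (c c' : Fin s → Carrier) v → comb c v +L comb c' v ≃ comb (λ i → c i + c' i) v
  comb-+ c c' v = ≃-trans (≃-sym (sumL-+ _ _)) (sumL-cong (λ i → ≃-sym (·L-distribʳ (c i) (c' i) (v i))))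

  ·L-comb : ∀ {s} x (c : Fin s → Carrier) v → x ·L comb c v ≃ comb (λ i → x * c i) v
  ·L-comb x c v = ≃-trans (·L-sumL x _) (sumL-cong (λ i → ≃-sym (·L-assoc x (c i) (v i))))

  comb-zero : ∀ {s} (c : Fin s → Carrier) v → (∀ i → c i ≈ 0#) → comb c v ≃ 0L
  comb-zero {zero} c v c≈0 = ≃-refl
  comb-zero {suc s} c v c≈0 = ≃-trans
    (+L-cong (≃-trans (·L-cong (c≈0 fzero) ≃-refl) (·L-zeroˡ (v fzero)))
             (comb-zero (λ i → c (fsuc i)) (λ i → v (fsuc i)) (λ i → c≈0 (fsuc i))))
    (+L-identityˡ 0L)

  restrict : ∀ {m p} {P : Fin m → Set p} → Decidable P → (Fin m → Carrier) → Fin m → Carrier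
  restrict P? c i = if ⌊ P? i ⌋ then c i else 0#

  module _ {m p} {P : Fin m → Set p} (P? : Decidable P) (c : Fin m → Carrier) where

    restrict-∈ : ∀ {i} → P i → restrict P? c i ≡ c i
    restrict-∈ {i} Pi with P? i
    ... | yes _ = ≡.refl
    ... | no ¬Pi = ⊥-elim (¬Pi Pi)

    restrict-∉ : ∀ {i} → ¬ P i → restrict P? c i ≡ 0#
    restrict-∉ {i} ¬Pi with P? i
    ... | yes Pi = ⊥-elim (¬Pi Pi)
    ... | no _ = ≡.refl

    comb-restrict-split : ∀ v → comb c v ≃ comb (restrict P? c) v +L comb (restrict (∁? P?) c) v
    comb-restrict-split v = ≃-trans (comb-cong v split) (≃-sym (comb-+ _ _ v))
      where
      split : ∀ i → c i ≈ restrict P? c i + restrict (∁? P?) c i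
      split i with P? i
      ... | yes _ = sym (+-identityʳ (c i))
      ... | no _ = sym (+-identityˡ (c i))

    divide-restrict : (∀ i → P i → a ∣A c i) → Σ (Fin m → Carrier) λ d → ∀ i → restrict P? c i ≈ a * d i
    divide-restrict c-div = d , d-spec
      where
      d : Fin m → Carrier
      d i with P? i
      ... | yes Pi = proj₁ (c-div i Pi)
      ... | no _ = 0#
      d-spec : ∀ i → restrict P? c i ≈ a * d i
      d-spec i with P? i
      ... | yes Pi = proj₂ (c-div i Pi)
      ... | no _ = sym (zeroʳ a)

  record IsSubmodule {p} (P : Loc → Set p) : Set (c ⊔ ℓ ⊔ p) where
    field
      ∈-resp-≃ : ∀ {x y} → x ≃ y → P x → P y
      0L∈ : P 0L
      +L-closed : ∀ x y → P x → P y → P (x +L y)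
      ·L-closed : ∀ λ' x → P x → P (λ' ·L x)

    sumL-closed : ∀ {s} (f : Fin s → Loc) → (∀ i → P (f i)) → P (sumL f)
    sumL-closed {zero} f f∈ = 0L∈
    sumL-closed {suc s} f f∈ = +L-closed _ _ (f∈ fzero) (sumL-closed (λ i → f (fsuc i)) (λ i → f∈ (fsuc i)))

    comb-closed : ∀ {s} c (v : Fin s → Loc) → (∀ i → P (v i)) → P (comb c v)
    comb-closed c v v∈ = sumL-closed _ (λ i → ·L-closed (c i) (v i) (v∈ i))

    0·L∈ : ∀ x → P (0# ·L x)
    0·L∈ x = ∈-resp-≃ (≃-sym (·L-zeroˡ x)) 0L∈

    span-⊆ : ∀ {s} (h : Fin s → Loc) → (∀ u → P (h u)) → ∀ x → Sub.InN h x → P x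
    span-⊆ h h∈ x (d , x≈) = ∈-resp-≃ (≃-sym (≈L⇒≃ {x} {comb d h} x≈)) (comb-closed d h h∈)

    ∈-+L-cancelʳ : ∀ x y → P (x +L y) → P y → P x
    ∈-+L-cancelʳ x y x+y∈ y∈ =
      ∈-resp-≃ (+L--L-cancelʳ x y) (+L-closed (x +L y) _ x+y∈ (·L-closed (- 1#) y y∈))

  ∩-isSubmodule : ∀ {p q} {P : Loc → Set p} {Q : Loc → Set q} →
                  IsSubmodule P → IsSubmodule Q → IsSubmodule (λ x → P x × Q x)
  ∩-isSubmodule P Q = record
    { ∈-resp-≃ = λ x≃y (p , q) → P.∈-resp-≃ x≃y p , Q.∈-resp-≃ x≃y q
    ; 0L∈ = P.0L∈ , Q.0L∈
    ; +L-closed = λ x y (p , q) (p' , q') → P.+L-closed x y p p' , Q.+L-closed x y q q'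
    ; ·L-closed = λ λ' x (p , q) → P.·L-closed λ' x p , Q.·L-closed λ' x q }
    where
    module P = IsSubmodule P
    module Q = IsSubmodule Q

  aPowZ-+ : ∀ j m m' → aPowZ j m +L aPowZ j m' ≃ aPowZ j (m +M m')
  aPowZ-+ (+ k) m m' = ≈L⇒≃ λ t →
    *-congˡ (trans (+-cong (*-identityˡ _) (*-identityˡ _)) (sym (distribˡ _ _ _)))
  aPowZ-+ -[1+ k ] m m' = ≈L⇒≃ λ t →
    trans (expand (pow a (suc k)) (m t) (m' t)) (*-congʳ (sym (pow-+ (suc k) (suc k))))
    where
    expand : ∀ A x y → A * (A * x + A * y) ≈ (A * A) * (x + y)
    expand = solve 3 (λ A x y → A :* (A :* x :+ A :* y) := (A :* A) :* (x :+ y)) refl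

  ·L-aPowZ : ∀ x j m → x ·L aPowZ j m ≃ aPowZ j (x ·M m)
  ·L-aPowZ x (+ k) m = ≈L⇒≃ λ t → *-congˡ (*-swapˡ _ _ _)
  ·L-aPowZ x -[1+ k ] m = ≃-refl

  aPowZ-0M : ∀ j → aPowZ j 0M ≃ 0L
  aPowZ-0M (+ k) = ≈L⇒≃ λ t → *-congˡ (zeroʳ _)
  aPowZ-0M -[1+ k ] = ≈L⇒≃ λ t → trans (zeroʳ _) (sym (zeroʳ _))

  aPowZ-suc : ∀ j m → aPowZ (sucℤ j) m ≃ a ·L aPowZ j m
  aPowZ-suc (+ k) m = ≈L⇒≃ λ t → *-congˡ (*-assoc _ _ _)
  aPowZ-suc -[1+ zero ] m = ≈L⇒≃ λ t → trans (*-cong (*-identityʳ a) (*-identityˡ _)) (sym (*-identityˡ _))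
  aPowZ-suc -[1+ suc k ] m = ≈L⇒≃ λ t → trans (*-assoc _ _ _) (*-swapˡ _ _ _)

  image-isSubmodule : ∀ {w} {W : Set w} (f : W → Loc)
    (0W : W) (_+W_ : W → W → W) (_·W_ : Carrier → W → W) →
    f 0W ≃ 0L → (∀ u v → f u +L f v ≃ f (u +W v)) → (∀ λ' u → λ' ·L f u ≃ f (λ' ·W u)) →
    IsSubmodule (λ x → Σ W λ u → x ≈L f u)
  image-isSubmodule f 0W _+W_ _·W_ f-0 f-+ f-· = record
    { ∈-resp-≃ = λ {x} {y} x≃y (u , x≈) → u , ≃⇒≈L (≃-trans (≃-sym x≃y) (≈L⇒≃ {x} {f u} x≈))
    ; 0L∈ = 0W , ≃⇒≈L (≃-sym f-0)
    ; +L-closed = λ x y (u , x≈) (v , y≈) → (u +W v) ,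
        ≃⇒≈L (≃-trans (+L-cong (≈L⇒≃ {x} {f u} x≈) (≈L⇒≃ {y} {f v} y≈)) (f-+ u v))
    ; ·L-closed = λ λ' x (u , x≈) → (λ' ·W u) ,
        ≃⇒≈L (≃-trans (·L-congˡ λ' (≈L⇒≃ {x} {f u} x≈)) (f-· λ' u)) }

  span-isSubmodule : ∀ {s} (h : Fin s → Loc) → IsSubmodule (Sub.InN h)
  span-isSubmodule h = image-isSubmodule (λ d → comb d h)
    (λ _ → 0#) (λ d d' i → d i + d' i) (λ λ' d i → λ' * d i)
    (comb-zero _ h (λ _ → refl)) (λ d d' → comb-+ d d' h) (λ λ' d → ·L-comb λ' d h)

  aPowM-isSubmodule : ∀ j → IsSubmodule (InaM j)
  aPowM-isSubmodule j = image-isSubmodule (aPowZ j) 0M _+M_ _·M_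
    (aPowZ-0M j) (aPowZ-+ j) (λ λ' → ·L-aPowZ λ' j)

  InaM-suc⇒InaM : ∀ j x → InaM (sucℤ j) x → InaM j x
  InaM-suc⇒InaM j x (m , x≈) = (a ·M m) ,
    ≃⇒≈L (≃-trans (≈L⇒≃ {x} {aPowZ (sucℤ j) m} x≈) (≃-trans (aPowZ-suc j m) (·L-aPowZ a j m)))

  InaM-mono : ∀ {i j} x → i ℤ.≤ j → InaM j x → InaM i x
  InaM-mono {i} x i≤j x∈ with ≤⇒≡+ i≤j
  ... | k , ≡.refl = go k x∈
    where
    go : ∀ k → InaM (i ℤ.+ + k) x → InaM i x
    go zero x∈ = subst (λ l → InaM l x) (ℤ.+-identityʳ i) x∈
    go (suc k) x∈ = go k (InaM-suc⇒InaM (i ℤ.+ + k) x (subst (λ l → InaM l x) (i+[1+j]≡1+[i+j] i (+ k)) x∈))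

  InaM-cancel-a : ∀ j x → InaM (sucℤ j) (a ·L x) → InaM j x
  InaM-cancel-a j x (m , ax≈) = m , ≃⇒≈L (·L-cancel-pow 1 (
    ≃-trans (·L-cong (*-identityʳ a) ≃-refl) (≃-trans (≈L⇒≃ {a ·L x} {aPowZ (sucℤ j) m} ax≈)
      (≃-trans (aPowZ-suc j m) (·L-cong (sym (*-identityʳ a)) ≃-refl)))))

  shift-cong : ∀ q {u v} → u ≃ v → shift q u ≃ shift q v
  shift-cong (+ j) {k , m} {k' , m'} (≈L⇒≃ p) = ≈L⇒≃ λ t → begin
    pow a (k' +ℕ j) * m t          ≈⟨ *-congʳ (pow-+ k' j) ⟩
    (pow a k' * pow a j) * m t     ≈⟨ reorder (pow a k') (pow a j) (m t) ⟩
    pow a j * (pow a k' * m t)     ≈⟨ *-congˡ (p t) ⟩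
    pow a j * (pow a k * m' t)     ≈⟨ sym (reorder (pow a k) (pow a j) (m' t)) ⟩
    (pow a k * pow a j) * m' t     ≈⟨ *-congʳ (sym (pow-+ k j)) ⟩
    pow a (k +ℕ j) * m' t          ∎
    where
    open ≈-Reasoning
    reorder : ∀ A B x → (A * B) * x ≈ B * (A * x)
    reorder = solve 3 (λ A B x → (A :* B) :* x := B :* (A :* x)) refl
  shift-cong -[1+ j ] {k , m} {k' , m'} (≈L⇒≃ p) = ≈L⇒≃ λ t →
    trans (*-swapˡ _ _ _) (trans (*-congˡ (p t)) (*-swapˡ _ _ _))

  shift-aPowZ : ∀ q m → shift q (aPowZ q m) ≃ ιM m
  shift-aPowZ (+ j) m = ≈L⇒≃ λ t → *-identityˡ _
  shift-aPowZ -[1+ j ] m = ≈L⇒≃ λ t → *-identityˡ _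

  pow-·L-shift : ∀ q K → ∣ q ∣ ≤ℕ K →
                 Σ ℕ λ ν → (q ℤ.+ + ν ≡ + K) × (∀ v → pow a K ·L shift q v ≃ pow a ν ·L v)
  pow-·L-shift (+ j) K j≤K = K ∸ j , cong +_ (ℕ.m+[n∸m]≡n j≤K) , λ v →
    subst (λ K' → pow a K' ·L shift (+ j) v ≃ pow a (K ∸ j) ·L v) (ℕ.m∸n+n≡m j≤K) (cancel (K ∸ j) v)
    where
    cancel : ∀ ν v → pow a (ν +ℕ j) ·L shift (+ j) v ≃ pow a ν ·L v
    cancel ν (k , m) = ≈L⇒≃ λ t → begin
      pow a k * (pow a (ν +ℕ j) * m t)        ≈⟨ *-congˡ (*-congʳ (pow-+ ν j)) ⟩
      pow a k * ((pow a ν * pow a j) * m t)   ≈⟨ reorder (pow a k) (pow a ν) (pow a j) (m t) ⟩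
      (pow a k * pow a j) * (pow a ν * m t)   ≈⟨ *-congʳ (sym (pow-+ k j)) ⟩
      pow a (k +ℕ j) * (pow a ν * m t)        ∎
      where
      open ≈-Reasoning
      reorder : ∀ A B C x → A * ((B * C) * x) ≈ (A * C) * (B * x)
      reorder = solve 4 (λ A B C x → A :* ((B :* C) :* x) := (A :* C) :* (B :* x)) refl
  pow-·L-shift -[1+ j ] K _ = K +ℕ suc j ,
    ≡.trans (ℤ.⊖-≥ (ℕ.m≤n+m (suc j) K)) (cong +_ (ℕ.m+n∸n≡m K (suc j))) ,
    λ (k , m) → ≈L⇒≃ λ t → *-congˡ (trans (sym (*-assoc _ _ _)) (*-congʳ (sym (pow-+ K (suc j)))))

  denominator≤⇒InaM : ∀ D x → proj₁ x ≤ℕ suc D → InaM -[1+ D ] x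
  denominator≤⇒InaM D (k , m) k≤D+1 = (pow a (suc D ∸ k) ·M m) , λ t → begin
    pow a (suc D) * m t                        ≡⟨ cong (λ e → pow a e * m t) (ℕ.m∸n+n≡m k≤D+1) ⟨
    pow a ((suc D ∸ k) +ℕ k) * m t             ≈⟨ *-congʳ (pow-+ (suc D ∸ k) k) ⟩
    (pow a (suc D ∸ k) * pow a k) * m t        ≈⟨ reorder _ _ _ ⟩
    pow a k * (pow a (suc D ∸ k) * m t)        ∎
    where
    open ≈-Reasoning
    reorder : ∀ A B x → (A * B) * x ≈ B * (A * x)
    reorder = solve 3 (λ A B x → (A :* B) :* x := B :* (A :* x)) refl

  δ : ∀ {k} → Fin k → Fin k → Carrier
  δ fzero fzero = 1#
  δ fzero (fsuc u) = 0#
  δ (fsuc t) fzero = 0#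
  δ (fsuc t) (fsuc u) = δ t u

  sum-δ : ∀ {k} (f : Fin k → Carrier) u → sum (λ t → f t * δ t u) ≈ f u
  sum-δ {suc k} f fzero =
    trans (+-cong (*-identityʳ _) (trans (sym (*-distribʳ-sum 0# (λ t → f (fsuc t)))) (zeroʳ _))) (+-identityʳ _)
  sum-δ {suc k} f (fsuc u) =
    trans (+-cong (zeroʳ _) (sum-δ {k} (λ t → f (fsuc t)) u)) (+-identityˡ _)

  ιM-sumL : ∀ {k} (F : Fin k → M) → sumL (λ t → ιM (F t)) ≃ ιM (λ u → sum (λ t → F t u))
  ιM-sumL {zero} F = ≃-refl
  ιM-sumL {suc k} F = ≃-trans (+L-congˡ (ιM (F fzero)) (ιM-sumL (λ t → F (fsuc t))))
    (≈L⇒≃ λ t → *-congˡ (+-cong (*-identityˡ _) (*-identityˡ _)))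

  ιM≃comb-δ : ∀ m → ιM m ≃ comb m (λ t → ιM (δ t))
  ιM≃comb-δ m = ≃-sym (≃-trans (ιM-sumL (λ t u → m t * δ t u))
    (≈L⇒≃ λ u → *-congˡ (sum-δ m u)))

  separated-bounded : Separated → ∀ D x → (∀ k → Σ M λ w → x ≃ pow a k ·L (D , w)) → x ≃ 0L
  separated-bounded separated D (l , m) x≃ = ≈L⇒≃ λ t →
    trans (*-identityˡ _) (trans (pow-nonZeroDivisor D (m t) (separated _ (divisible t))) (sym (zeroʳ _)))
    where
    divisible : ∀ t k → pow a k ∣A (pow a D * m t)
    divisible t k = pow a l * proj₁ (x≃ k) t ,
      trans (≃⇒≈L (proj₂ (x≃ k)) t) (*-swapˡ _ _ _)

module Filtered {c₀ ℓ₀} (R : CommutativeRing c₀ ℓ₀) (n : ℕ) (a : CommutativeRing.Carrier R)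
                (a-nonZeroDivisor : Ctx.NonZeroDivisor R n a) {s : ℕ} (h : Fin s → Ctx.Loc R n a) where
  open CommutativeRing R
  open Ctx R n a
  open Sub h
  open Localisation R n a a-nonZeroDivisor
  open import Algebra.Solver.Ring.NaturalCoefficients commutativeSemiring (λ _ _ → nothing)
    using (solve; _:*_; _:=_)
  open import Algebra.Properties.Ring ring using (-‿distribʳ-*)
  open import Algebra.Properties.Group +-group using (//-rightDividesˡ; //-rightDividesʳ)
  open import Algebra.Solver.CommutativeMonoid +L-commutativeMonoid using (_⊕_; _⊜_) renaming (solve to +L-solve)

  N-isSubmodule : IsSubmodule InN
  N-isSubmodule = span-isSubmodule h
  module N = IsSubmodule N-isSubmodule

  F-isSubmodule : ∀ j → IsSubmodule (InFN j)
  F-isSubmodule j = ∩-isSubmodule (aPowM-isSubmodule j) N-isSubmodule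
  module F j = IsSubmodule (F-isSubmodule j)

  F-mono : ∀ {i j} x → i ℤ.≤ j → InFN j x → InFN i x
  F-mono x i≤j (x∈aM , x∈N) = InaM-mono x i≤j x∈aM , x∈N

  FaN-isSubmodule : ∀ j → IsSubmodule (InFN+aN j)
  FaN-isSubmodule j = record
    { ∈-resp-≃ = λ {x} {x'} x≃x' (y , z , y∈ , z∈ , x≈) →
        y , z , y∈ , z∈ , ≃⇒≈L (≃-trans (≃-sym x≃x') (≈L⇒≃ {x} {y +L (a ·L z)} x≈))
    ; 0L∈ = 0L , 0L , F.0L∈ j , N.0L∈ ,
        ≃⇒≈L (≃-sym (≃-trans (+L-congˡ 0L (·L-zeroʳ a)) (+L-identityˡ 0L)))
    ; +L-closed = λ x x' (y , z , y∈ , z∈ , x≈) (y' , z' , y'∈ , z'∈ , x'≈) →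
        (y +L y') , (z +L z') , F.+L-closed j y y' y∈ y'∈ , N.+L-closed z z' z∈ z'∈ ,
        ≃⇒≈L (≃-trans (+L-cong (≈L⇒≃ {x} {y +L (a ·L z)} x≈) (≈L⇒≃ {x'} {y' +L (a ·L z')} x'≈))
               (≃-trans (+L-interchange y (a ·L z) y' (a ·L z')) (+L-congˡ (y +L y') (≃-sym (·L-distribˡ a z z')))))
    ; ·L-closed = λ λ' x (y , z , y∈ , z∈ , x≈) →
        (λ' ·L y) , (λ' ·L z) , F.·L-closed j λ' y y∈ , N.·L-closed λ' z z∈ ,
        ≃⇒≈L (≃-trans (·L-congˡ λ' (≈L⇒≃ {x} {y +L (a ·L z)} x≈))
               (≃-trans (·L-distribˡ λ' y (a ·L z)) (+L-congˡ (λ' ·L y) (·L-comm λ' a z)))) }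
  module FaN j = IsSubmodule (FaN-isSubmodule j)

  F⊆FaN : ∀ j x → InFN j x → InFN+aN j x
  F⊆FaN j x x∈ = x , 0L , x∈ , N.0L∈ ,
    ≃⇒≈L (≃-sym (≃-trans (+L-congˡ x (·L-zeroʳ a)) (+L-identityʳ x)))

  aN⊆FaN : ∀ j z → InN z → InFN+aN j (a ·L z)
  aN⊆FaN j z z∈ = 0L , z , F.0L∈ j , z∈ , ≃⇒≈L (≃-sym (+L-identityˡ (a ·L z)))

  B : ℕ
  B = ∑ℕ (λ u → proj₁ (h u))

  N⊆aPowM : ∀ x → InN x → InaM -[1+ B ] x
  N⊆aPowM = IsSubmodule.span-⊆ (aPowM-isSubmodule -[1+ B ]) h
    (λ u → denominator≤⇒InaM B (h u) (ℕ.≤-trans (≤∑ℕ (λ u → proj₁ (h u)) u) (ℕ.n≤1+n B)))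

  N-separated : Separated → ∀ {u v} → (∀ k → Σ Loc λ w → InN w × (u ≃ v +L (pow a k ·L w))) → u ≃ v
  N-separated separated {u} {v} close = -L≃0⇒≃ (separated-bounded separated (suc B) (u -L v) λ k →
    let (w , w∈N , u≃) = close k
        (mw , w≈) = N⊆aPowM w w∈N
    in mw , ≃-trans (≃+L⇒-L≃ u≃) (·L-congˡ (pow a k) (≈L⇒≃ {w} {aPowZ -[1+ B ] mw} w≈)))

  module Saturation (localizes : LocalizesToAll) where

    K : ℕ
    K = ∑ℕ (λ t → proj₁ (localizes (ιM (δ t))))

    aPowM⊆N : ∀ mx → InN (pow a K ·L ιM mx)
    aPowM⊆N mx = N.∈-resp-≃ (≃-sym (≃-trans (·L-congˡ (pow a K) (ιM≃comb-δ mx))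
                                  (≃-trans (·L-comb (pow a K) mx E₀) (sumL-cong rescale))))
                   (N.comb-closed (λ t → mx t * pow a (K ∸ k t)) E (λ t → proj₂ (localizes (E₀ t))))
      where
      E₀ : Fin n → Loc
      E₀ t = ιM (δ t)
      k : Fin n → ℕ
      k t = proj₁ (localizes (E₀ t))
      E : Fin n → Loc
      E t = pow a (k t) ·L E₀ t
      rescale : ∀ t → (pow a K * mx t) ·L E₀ t ≃ (mx t * pow a (K ∸ k t)) ·L E t
      rescale t = ≃-trans (·L-cong split ≃-refl) (·L-assoc _ (pow a (k t)) (E₀ t))
        where
        open ≈-Reasoning
        split : pow a K * mx t ≈ (mx t * pow a (K ∸ k t)) * pow a (k t)
        split = begin
          pow a K * mx t                              ≡⟨ cong (λ e → pow a e * mx t) (ℕ.m∸n+n≡m (≤∑ℕ k t)) ⟨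
          pow a ((K ∸ k t) +ℕ k t) * mx t             ≈⟨ *-congʳ (pow-+ (K ∸ k t) (k t)) ⟩
          (pow a (K ∸ k t) * pow a (k t)) * mx t      ≈⟨ reorder _ _ _ ⟩
          (mx t * pow a (K ∸ k t)) * pow a (k t)      ∎
          where
          reorder : ∀ A B x → (A * B) * x ≈ (x * A) * B
          reorder = solve 3 (λ A B x → (A :* B) :* x := (x :* A) :* B) refl

    F-top⊆aN : ∀ x → InFN (+ suc K) x → Σ Loc λ w → InN w × (x ≃ a ·L w)
    F-top⊆aN x ((mx , x≈) , _) = (pow a K ·L ιM mx) , aPowM⊆N mx ,
      ≃-trans (≈L⇒≃ {x} {aPowZ (+ suc K) mx} x≈) (≈L⇒≃ λ t → *-congˡ (*-assoc a (pow a K) (mx t)))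

  module GradedBasis {m} (g : Fin m → Loc) (r : Fin m → ℤ)
                     (g∈F : ∀ i → InFN (r i) (g i)) (gr-basis : IsGrBasis g r) where

    -- grComb c g r j is definitionally comb (atLevel j c) g.
    atLevel : ℤ → (Fin m → Carrier) → Fin m → Carrier
    atLevel j = restrict (λ i → r i ≟ j)

    gr-independent : ∀ j c → InFN+aN (sucℤ j) (comb (atLevel j c) g) → ∀ i → r i ≡ j → a ∣A c i
    gr-independent j c atLevel∈ i ri≡j =
      subst (a ∣A_) (restrict-∈ (λ i → r i ≟ j) c ri≡j) (proj₂ gr-basis (atLevel j c) vanishes i)
      where
      vanishes : grComb (atLevel j c) g r ≈gr zeroGr
      vanishes j' with j' ≟ j
      ... | yes ≡.refl = FaN.∈-resp-≃ (sucℤ j) (≃-sym (≃-trans (-L-identityʳ _) (comb-cong g idem))) atLevel∈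
        where
        idem : ∀ i → atLevel j (atLevel j c) i ≈ atLevel j c i
        idem i with r i ≟ j
        ... | yes _ = refl
        ... | no _ = refl
      ... | no j'≢j = FaN.∈-resp-≃ (sucℤ j') (≃-sym (≃-trans (-L-identityʳ _) (comb-zero _ g disjoint)))
                        (FaN.0L∈ (sucℤ j'))
        where
        disjoint : ∀ i → atLevel j' (atLevel j c) i ≈ 0#
        disjoint i with r i ≟ j'
        ... | yes ri≡j' = reflexive (restrict-∉ (λ i → r i ≟ j) c (λ ri≡j → j'≢j (≡.trans (≡.sym ri≡j') ri≡j)))
        ... | no _ = refl

    concentratedAt : ℤ → Loc → ℤ → Loc
    concentratedAt j x j' = if ⌊ j' ≟ j ⌋ then x else 0L

    gr-spanning : ∀ j x → InFN j x → Σ (Fin m → Carrier) λ c → InFN+aN (sucℤ j) (x -L comb (atLevel j c) g)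
    gr-spanning j x x∈ = c , subst (λ y → InFN+aN (sucℤ j) (y -L comb (atLevel j c) g)) at-j (approx j)
      where
      levels : ∀ j' → InFN j' (concentratedAt j x j')
      levels j' with j' ≟ j
      ... | yes ≡.refl = x∈
      ... | no _ = F.0L∈ j'
      beyond : ∀ j' → ∣ j ∣ <ℕ ∣ j' ∣ → InFN+aN (sucℤ j') (concentratedAt j x j')
      beyond j' lt with j' ≟ j
      ... | yes ≡.refl = ⊥-elim (ℕ.<-irrefl ≡.refl lt)
      ... | no _ = FaN.0L∈ (sucℤ j')
      at-j : concentratedAt j x j ≡ x
      at-j with j ≟ j
      ... | yes _ = ≡.refl
      ... | no j≢j = ⊥-elim (j≢j ≡.refl)
      c = proj₁ (proj₁ gr-basis (concentratedAt j x) (levels , ∣ j ∣ , beyond))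
      approx = proj₂ (proj₁ gr-basis (concentratedAt j x) (levels , ∣ j ∣ , beyond))

    ·g∈F : ∀ {j} λ' i → j ℤ.≤ r i → InFN j (λ' ·L g i)
    ·g∈F {j} λ' i j≤r = F.·L-closed j λ' (g i) (F-mono (g i) j≤r (g∈F i))

    a∣·g∈FaN : ∀ j {λ'} i → a ∣A λ' → InFN+aN j (λ' ·L g i)
    a∣·g∈FaN j i (z , λ'≈az) =
      FaN.∈-resp-≃ j (≃-sym (≃-trans (·L-cong λ'≈az (≃-refl {g i})) (·L-assoc a z (g i))))
        (aN⊆FaN j (z ·L g i) (N.·L-closed z (g i) (proj₂ (g∈F i))))

    atLevel-∈FaN : ∀ p c → InFN (sucℤ p) (comb c g) → (∀ i → r i ℤ.< p → a ∣A c i) →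
                   InFN+aN (sucℤ p) (comb (atLevel p c) g)
    atLevel-∈FaN p c c∈ below-div = FaN.∈-+L-cancelʳ (sucℤ p) (comb (atLevel p c) g) (comb offLevel g)
      (FaN.∈-resp-≃ (sucℤ p) (comb-restrict-split (λ i → r i ≟ p) c g) (F⊆FaN (sucℤ p) (comb c g) c∈))
      (FaN.sumL-closed (sucℤ p) (λ i → offLevel i ·L g i) offLevel∈)
      where
      offLevel = restrict (∁? (λ i → r i ≟ p)) c
      offLevel∈ : ∀ i → InFN+aN (sucℤ p) (offLevel i ·L g i)
      offLevel∈ i with r i ≟ p
      ... | yes _ = FaN.0·L∈ (sucℤ p) (g i)
      ... | no ri≢p with r i <? p
      ...   | yes ri<p = a∣·g∈FaN (sucℤ p) i (below-div i ri<p)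
      ...   | no ri≮p = F⊆FaN (sucℤ p) (c i ·L g i)
          (·g∈F (c i) i (ℤ.i<j⇒suc[i]≤j (ℤ.≤∧≢⇒< (ℤ.≮⇒≥ ri≮p) (λ p≡ri → ri≢p (≡.sym p≡ri)))))

    S : ℕ
    S = ∑ℕ (λ i → ∣ r i ∣)

    -S≤r : ∀ i → ℤ.- (+ S) ℤ.≤ r i
    -S≤r i = ℤ.≤-trans (ℤ.neg-mono-≤ (ℤ.+≤+ (≤∑ℕ (λ i → ∣ r i ∣) i))) (-∣i∣≤i (r i))

    -- Induction on the level p from -S upwards: once a divides the c_i with r_i < p, the
    -- level-p part of Σ c_i g_i lies in F^(p+1) N + aN, so gr-independence applies.
    divisible-below : ∀ j c → InFN j (comb c g) → ∀ i → r i ℤ.< j → a ∣A c i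
    divisible-below j c c∈ i ri<j = below (suc k) i ri<level ri<j
      where
      level : ℕ → ℤ
      level k = ℤ.- (+ S) ℤ.+ + k
      k = proj₁ (≤⇒≡+ (-S≤r i))
      ri<level : r i ℤ.< level (suc k)
      ri<level = subst (ℤ._< level (suc k)) (≡.sym (proj₂ (≤⇒≡+ (-S≤r i))))
                   (ℤ.+-monoʳ-< (ℤ.- (+ S)) (ℤ.+<+ (ℕ.n<1+n k)))
      below : ∀ k i → r i ℤ.< level k → r i ℤ.< j → a ∣A c i
      below zero i ri<l _ = ⊥-elim (ℤ.<⇒≱ (subst (r i ℤ.<_) (ℤ.+-identityʳ _) ri<l) (-S≤r i))
      below (suc k) i ri<l ri<j with r i <? level k
      ... | yes ri<lk = below k i ri<lk ri<j
      ... | no ri≮lk = gr-independent (level k) c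
                         (atLevel-∈FaN (level k) c (F-mono (comb c g) (ℤ.i<j⇒suc[i]≤j lk<j) c∈) lower) i ri≡lk
        where
        ri≡lk : r i ≡ level k
        ri≡lk = ℤ.≤∧≮⇒≡ (<suc⇒≤ (subst (r i ℤ.<_) (i+[1+j]≡1+[i+j] (ℤ.- (+ S)) (+ k)) ri<l)) ri≮lk
        lk<j : level k ℤ.< j
        lk<j = subst (ℤ._< j) ri≡lk ri<j
        lower : ∀ i' → r i' ℤ.< level k → a ∣A c i'
        lower i' ri'<lk = below k i' ri'<lk (ℤ.<-trans ri'<lk lk<j)

    -- Dividing the coefficients with r_i < j by a gives a combination in F^(j-1) N.
    divisible-by-pow : ∀ k j c → InFN j (comb c g) → ∀ i → r i ℤ.+ + k ℤ.≤ j → pow a k ∣A c i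
    divisible-by-pow zero j c c∈ i _ = c i , sym (*-identityˡ (c i))
    divisible-by-pow (suc k) j c c∈ i ri+k+1≤j = proj₁ IH , (begin
      c i                       ≡⟨ restrict-∈ below? c ri<j ⟨
      restrict below? c i       ≈⟨ d-spec i ⟩
      a * d i                   ≈⟨ *-congˡ (proj₂ IH) ⟩
      a * (pow a k * proj₁ IH)  ≈⟨ *-assoc _ _ _ ⟨
      pow a (suc k) * proj₁ IH  ∎)
      where
      open ≈-Reasoning
      below? = λ i → r i <? j
      d = proj₁ (divide-restrict below? c (divisible-below j c c∈))
      d-spec = proj₂ (divide-restrict below? c (divisible-below j c c∈))
      notBelow∈ : ∀ i → InFN j (restrict (∁? below?) c i ·L g i)
      notBelow∈ i with r i <? j
      ... | yes _ = F.0·L∈ j (g i)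
      ... | no ri≮j = ·g∈F (c i) i (ℤ.≮⇒≥ ri≮j)
      ad∈F : InFN j (a ·L comb d g)
      ad∈F = F.∈-resp-≃ j (≃-trans (comb-cong g d-spec) (≃-sym (·L-comb a d g)))
        (F.∈-+L-cancelʳ j (comb (restrict below? c) g) (comb (restrict (∁? below?) c) g)
          (F.∈-resp-≃ j (comb-restrict-split below? c g) c∈)
          (F.sumL-closed j (λ i → restrict (∁? below?) c i ·L g i) notBelow∈))
      d∈F : InFN (ℤ.pred j) (comb d g)
      d∈F = InaM-cancel-a (ℤ.pred j) (comb d g)
              (subst (λ l → InaM l (a ·L comb d g)) (≡.sym (ℤ.suc-pred j)) (proj₁ ad∈F)) ,
            N.comb-closed d g (λ i → proj₂ (g∈F i))
      ri+k<j : r i ℤ.+ + k ℤ.< j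
      ri+k<j = ℤ.suc[i]≤j⇒i<j (subst (ℤ._≤ j) (i+[1+j]≡1+[i+j] (r i) (+ k)) ri+k+1≤j)
      ri<j : r i ℤ.< j
      ri<j = ℤ.≤-<-trans (ℤ.i≤i+j (r i) (+ k)) ri+k<j
      IH = divisible-by-pow k (ℤ.pred j) d d∈F i (ℤ.i<j⇒i≤pred[j] ri+k<j)

    g-independent : Separated → ∀ c → comb c g ≃ 0L → ∀ i → c i ≈ 0#
    g-independent separated c c≃0 i = separated (c i) λ k →
      divisible-by-pow k (r i ℤ.+ + k) c (F.∈-resp-≃ (r i ℤ.+ + k) (≃-sym c≃0) (F.0L∈ (r i ℤ.+ + k))) i ℤ.≤-refl

    DecomposesModA : Loc → Set (c₀ ⊔ ℓ₀)
    DecomposesModA x = Σ (Fin m → Carrier) λ c → Σ Loc λ w → InN w × (x ≃ comb c g +L (a ·L w))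

    module Decomposition (localizes : LocalizesToAll) where
      open Saturation localizes

      -- Peel off one graded piece per level until level K + 1, where F N ⊆ aN.
      F-decomposes : ∀ k j x → + suc K ℤ.≤ j ℤ.+ + k → InFN j x → DecomposesModA x
      F-decomposes zero j x K+1≤j+k x∈ =
        fromTop (F-top⊆aN x (F-mono x (subst (+ suc K ℤ.≤_) (ℤ.+-identityʳ j) K+1≤j+k) x∈))
        where
        fromTop : Σ Loc (λ w → InN w × (x ≃ a ·L w)) → DecomposesModA x
        fromTop (w , w∈N , x≃aw) = (λ _ → 0#) , w , w∈N ,
          ≃-trans x≃aw (≃-sym (≃-trans (+L-congʳ (a ·L w) (comb-zero _ g (λ _ → refl))) (+L-identityˡ _)))
      F-decomposes (suc k) j x K+1≤j+k x∈ = fromLevel (gr-spanning j x x∈)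
        where
        fromLevel : Σ (Fin m → Carrier) (λ c → InFN+aN (sucℤ j) (x -L comb (atLevel j c) g)) → DecomposesModA x
        fromLevel (c , y , z , y∈F , z∈N , x-C≈) =
          addLevel (F-decomposes k (sucℤ j) y (subst (+ suc K ℤ.≤_) (i+[1+j]≡[1+i]+j j (+ k)) K+1≤j+k) y∈F)
          where
          C = comb (atLevel j c) g
          addLevel : DecomposesModA y → DecomposesModA x
          addLevel (c' , w' , w'∈N , y≃) = (λ i → atLevel j c i + c' i) , (w' +L z) , N.+L-closed w' z w'∈N z∈N , (begin
            x                                                   ≈⟨ -L-+L-cancelʳ x C ⟨
            (x -L C) +L C                                       ≈⟨ +L-congʳ C (≈L⇒≃ {x -L C} {y +L (a ·L z)} x-C≈) ⟩
            (y +L (a ·L z)) +L C                                ≈⟨ +L-congʳ C (+L-congʳ (a ·L z) y≃) ⟩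
            ((comb c' g +L (a ·L w')) +L (a ·L z)) +L C         ≈⟨ regroup (comb c' g) (a ·L w') (a ·L z) C ⟩
            (C +L comb c' g) +L ((a ·L w') +L (a ·L z))         ≈⟨ +L-cong (comb-+ (atLevel j c) c' g) (≃-sym (·L-distribˡ a w' z)) ⟩
            comb (λ i → atLevel j c i + c' i) g +L (a ·L (w' +L z)) ∎)
            where
            open ≃-Reasoning
            regroup : ∀ p q u v → ((p +L q) +L u) +L v ≃ (v +L p) +L (q +L u)
            regroup = +L-solve 4 (λ p q u v → ((p ⊕ q) ⊕ u) ⊕ v ⊜ (v ⊕ p) ⊕ (q ⊕ u)) ≃-refl

      N-decomposes : ∀ x → InN x → DecomposesModA x
      N-decomposes x x∈N = F-decomposes k -[1+ B ] x (ℤ.≤-reflexive K≡) (N⊆aPowM x x∈N , x∈N)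
        where
        k = proj₁ (≤⇒≡+ (ℤ.-≤+ {B} {suc K}))
        K≡ = proj₂ (≤⇒≡+ (ℤ.-≤+ {B} {suc K}))

    module Approximation (complete : Complete) (localizes : LocalizesToAll) (x : Loc) (x∈N : InN x) where
      open Decomposition localizes

      decompose : (y : Σ Loc InN) → DecomposesModA (proj₁ y)
      decompose (y , y∈N) = N-decomposes y y∈N

      remainder : ℕ → Σ Loc InN
      remainder zero = x , x∈N
      remainder (suc k) = let (_ , w , w∈N , _) = decompose (remainder k) in w , w∈N

      digits : ℕ → Fin m → Carrier
      digits k = proj₁ (decompose (remainder k))

      remainder-step : ∀ k → proj₁ (remainder k) ≃ comb (digits k) g +L (a ·L proj₁ (remainder (suc k)))
      remainder-step k = proj₂ (proj₂ (proj₂ (decompose (remainder k))))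

      partialSum : ℕ → Fin m → Carrier
      partialSum zero i = 0#
      partialSum (suc k) i = partialSum k i + pow a k * digits k i

      partialSum-spec : ∀ k → x ≃ comb (partialSum k) g +L (pow a k ·L proj₁ (remainder k))
      partialSum-spec zero = begin
        x                               ≈⟨ ·L-identity x ⟨
        1# ·L x                         ≈⟨ +L-identityˡ (1# ·L x) ⟨
        0L +L (1# ·L x)                 ≈⟨ +L-congʳ (1# ·L x) (comb-zero _ g (λ _ → refl)) ⟨
        comb (partialSum 0) g +L (1# ·L x) ∎
        where open ≃-Reasoning
      partialSum-spec (suc k) = begin
        x                                                        ≈⟨ partialSum-spec k ⟩
        P +L (pow a k ·L ρ)                                      ≈⟨ +L-congˡ P (·L-congˡ (pow a k) (remainder-step k)) ⟩
        P +L (pow a k ·L (comb (digits k) g +L (a ·L ρ')))       ≈⟨ +L-congˡ P (·L-distribˡ (pow a k) (comb (digits k) g) (a ·L ρ')) ⟩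
        P +L ((pow a k ·L comb (digits k) g) +L (pow a k ·L (a ·L ρ')))
          ≈⟨ +L-congˡ P (+L-cong (·L-comb (pow a k) (digits k) g) (·L-comm (pow a k) a ρ')) ⟩
        P +L (comb (λ i → pow a k * digits k i) g +L (a ·L (pow a k ·L ρ')))
          ≈⟨ +L-congˡ P (+L-congˡ (comb (λ i → pow a k * digits k i) g) (·L-assoc a (pow a k) ρ')) ⟨
        P +L (comb (λ i → pow a k * digits k i) g +L (pow a (suc k) ·L ρ'))
          ≈⟨ +L-assoc P (comb (λ i → pow a k * digits k i) g) (pow a (suc k) ·L ρ') ⟨
        (P +L comb (λ i → pow a k * digits k i) g) +L (pow a (suc k) ·L ρ')
          ≈⟨ +L-congʳ (pow a (suc k) ·L ρ') (comb-+ (partialSum k) _ g) ⟩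
        comb (partialSum (suc k)) g +L (pow a (suc k) ·L ρ')     ∎
        where
        open ≃-Reasoning
        P = comb (partialSum k) g
        ρ = proj₁ (remainder k)
        ρ' = proj₁ (remainder (suc k))

      partialSum-cauchy : ∀ i k → pow a k ∣A (partialSum (suc k) i - partialSum k i)
      partialSum-cauchy i k = digits k i ,
        trans (+-congʳ (+-comm (partialSum k i) _)) (//-rightDividesʳ (partialSum k i) _)

      limit : Fin m → Carrier
      limit i = proj₁ (complete (λ k → partialSum k i) (partialSum-cauchy i))

      limit-error : ℕ → Fin m → Carrier
      limit-error k i = proj₁ (proj₂ (complete (λ k → partialSum k i) (partialSum-cauchy i)) k)

      partialSum≈ : ∀ k i → partialSum k i ≈ limit i + pow a k * - limit-error k i
      partialSum≈ k i = begin
        partialSum k i                 ≈⟨ //-rightDividesʳ e (partialSum k i) ⟨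
        (partialSum k i + e) - e       ≈⟨ +-congʳ (trans (+-comm _ e) (trans (+-congʳ e≈) (//-rightDividesˡ _ (limit i)))) ⟩
        limit i - e                    ≈⟨ +-congˡ (-‿distribʳ-* (pow a k) (limit-error k i)) ⟩
        limit i + pow a k * - limit-error k i ∎
        where
        open ≈-Reasoning
        e = pow a k * limit-error k i
        e≈ : e ≈ limit i - partialSum k i
        e≈ = sym (proj₂ (proj₂ (complete (λ k → partialSum k i) (partialSum-cauchy i)) k))

      limit-close : ∀ k → Σ Loc λ w → InN w × (x ≃ comb limit g +L (pow a k ·L w))
      limit-close k = (E +L ρ) ,
        N.+L-closed E ρ (N.comb-closed _ g (λ i → proj₂ (g∈F i))) (proj₂ (remainder k)) , (begin
          x                                                   ≈⟨ partialSum-spec k ⟩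
          comb (partialSum k) g +L (pow a k ·L ρ)             ≈⟨ +L-congʳ (pow a k ·L ρ) (comb-cong g (partialSum≈ k)) ⟩
          comb (λ i → limit i + aᵏ·ε i) g +L (pow a k ·L ρ)   ≈⟨ +L-congʳ (pow a k ·L ρ) (comb-+ limit aᵏ·ε g) ⟨
          (comb limit g +L comb aᵏ·ε g) +L (pow a k ·L ρ)     ≈⟨ +L-assoc (comb limit g) _ _ ⟩
          comb limit g +L (comb aᵏ·ε g +L (pow a k ·L ρ))     ≈⟨ +L-congˡ (comb limit g) (+L-congʳ (pow a k ·L ρ) (·L-comb (pow a k) _ g)) ⟨
          comb limit g +L ((pow a k ·L E) +L (pow a k ·L ρ))  ≈⟨ +L-congˡ (comb limit g) (·L-distribˡ (pow a k) E ρ) ⟨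
          comb limit g +L (pow a k ·L (E +L ρ))               ∎)
        where
        open ≃-Reasoning
        ρ = proj₁ (remainder k)
        aᵏ·ε : Fin m → Carrier
        aᵏ·ε i = pow a k * - limit-error k i
        E = comb (λ i → - limit-error k i) g

    g-spans : Separated → Complete → LocalizesToAll → ∀ x → InN x → Σ (Fin m → Carrier) λ c → x ≃ comb c g
    g-spans separated complete localizes x x∈N = limit , N-separated separated limit-close
      where open Approximation complete localizes x x∈N

    e : Fin m → Loc
    e i = shift (r i) (g i)

    e∈M : ∀ i → InM (e i)
    e∈M i = mg , ≃⇒≈L (≃-trans (shift-cong (r i) (≈L⇒≃ {g i} {aPowZ (r i) mg} g≈)) (shift-aPowZ (r i) mg))
      where
      mg = proj₁ (proj₁ (g∈F i))
      g≈ = proj₂ (proj₁ (g∈F i))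

    rescale-e : ∀ i → Σ ℕ λ ν → (r i ℤ.+ + ν ≡ + S) × (pow a S ·L e i ≃ pow a ν ·L g i)
    rescale-e i = let (ν , r+ν≡S , rescale) = pow-·L-shift (r i) S (≤∑ℕ (λ i → ∣ r i ∣) i)
                  in ν , r+ν≡S , rescale (g i)

    e-independent : Separated → ∀ c → comb c e ≃ 0L → ∀ i → c i ≈ 0#
    e-independent separated c c≃0 i =
      pow-nonZeroDivisor (ν i) (c i) (trans (*-comm _ _) (g-independent separated (λ i → c i * pow a (ν i)) rescaled i))
      where
      ν : Fin m → ℕ
      ν i = proj₁ (rescale-e i)
      term : ∀ i → (c i * pow a (ν i)) ·L g i ≃ (pow a S * c i) ·L e i
      term i = begin
        (c i * pow a (ν i)) ·L g i     ≈⟨ ·L-assoc (c i) (pow a (ν i)) (g i) ⟩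
        c i ·L (pow a (ν i) ·L g i)    ≈⟨ ·L-congˡ (c i) (proj₂ (proj₂ (rescale-e i))) ⟨
        c i ·L (pow a S ·L e i)        ≈⟨ ·L-comm (c i) (pow a S) (e i) ⟩
        pow a S ·L (c i ·L e i)        ≈⟨ ·L-assoc (pow a S) (c i) (e i) ⟨
        (pow a S * c i) ·L e i         ∎
        where open ≃-Reasoning
      rescaled : comb (λ i → c i * pow a (ν i)) g ≃ 0L
      rescaled = begin
        comb (λ i → c i * pow a (ν i)) g   ≈⟨ sumL-cong term ⟩
        comb (λ i → pow a S * c i) e       ≈⟨ ·L-comb (pow a S) c e ⟨
        pow a S ·L comb c e                ≈⟨ ·L-congˡ (pow a S) c≃0 ⟩
        pow a S ·L 0L                      ≈⟨ ·L-zeroʳ (pow a S) ⟩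
        0L                                 ∎
        where open ≃-Reasoning

    -- a^(S+k) x lies in N ∩ a^(S+k) M, so its coefficient at g_i is divisible by a^(S+k-r_i).
    e-spans : Separated → Complete → LocalizesToAll → ∀ x → InM x → Σ (Fin m → Carrier) λ c → x ≃ comb c e
    e-spans separated complete localizes x (mx , x≈) = z , ·L-cancel-pow (S +ℕ k) (begin
      pow a (S +ℕ k) ·L x                  ≈⟨ y≃ ⟩
      comb c g                             ≈⟨ sumL-cong term ⟩
      comb (λ i → pow a (S +ℕ k) * z i) e  ≈⟨ ·L-comb (pow a (S +ℕ k)) z e ⟨
      pow a (S +ℕ k) ·L comb z e           ∎)
      where
      open ≃-Reasoning
      k = proj₁ (localizes x)
      y = pow a (S +ℕ k) ·L x
      y∈N : InN y
      y∈N = N.∈-resp-≃ (≃-trans (≃-sym (·L-assoc (pow a S) (pow a k) x)) (·L-cong (sym (pow-+ S k)) ≃-refl))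
              (N.·L-closed (pow a S) (pow a k ·L x) (proj₂ (localizes x)))
      y∈aM : InaM (+ (S +ℕ k)) y
      y∈aM = mx , ≃⇒≈L (·L-congˡ (pow a (S +ℕ k)) (≈L⇒≃ {x} {ιM mx} x≈))
      c = proj₁ (g-spans separated complete localizes y y∈N)
      y≃ = proj₂ (g-spans separated complete localizes y y∈N)
      ν : Fin m → ℕ
      ν i = proj₁ (rescale-e i)
      c-divisible : ∀ i → pow a (ν i +ℕ k) ∣A c i
      c-divisible i = divisible-by-pow (ν i +ℕ k) (+ (S +ℕ k)) c (F.∈-resp-≃ (+ (S +ℕ k)) y≃ (y∈aM , y∈N)) i
        (ℤ.≤-reflexive (≡.trans (≡.sym (ℤ.+-assoc (r i) (+ ν i) (+ k))) (cong (ℤ._+ + k) (proj₁ (proj₂ (rescale-e i))))))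
      z : Fin m → Carrier
      z i = proj₁ (c-divisible i)
      term : ∀ i → c i ·L g i ≃ (pow a (S +ℕ k) * z i) ·L e i
      term i = begin
        c i ·L g i                                      ≈⟨ ·L-cong (trans (proj₂ (c-divisible i)) (*-congʳ (pow-+ (ν i) k))) ≃-refl ⟩
        ((pow a (ν i) * pow a k) * z i) ·L g i          ≈⟨ ·L-cong (rotate _ _ _) ≃-refl ⟩
        ((pow a k * z i) * pow a (ν i)) ·L g i          ≈⟨ ·L-assoc (pow a k * z i) (pow a (ν i)) (g i) ⟩
        (pow a k * z i) ·L (pow a (ν i) ·L g i)         ≈⟨ ·L-congˡ (pow a k * z i) (proj₂ (proj₂ (rescale-e i))) ⟨
        (pow a k * z i) ·L (pow a S ·L e i)             ≈⟨ ·L-assoc (pow a k * z i) (pow a S) (e i) ⟨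
        ((pow a k * z i) * pow a S) ·L e i              ≈⟨ ·L-cong (trans (rotate⁻¹ _ _ _) (*-congʳ (sym (pow-+ S k)))) ≃-refl ⟩
        (pow a (S +ℕ k) * z i) ·L e i                   ∎
        where
        rotate : ∀ A B C → (A * B) * C ≈ (B * C) * A
        rotate = solve 3 (λ A B C → (A :* B) :* C := (B :* C) :* A) refl
        rotate⁻¹ : ∀ A B C → (A * B) * C ≈ (C * A) * B
        rotate⁻¹ = solve 3 (λ A B C → (A :* B) :* C := (C :* A) :* B) refl

lemma3p7 : ∀ {c ℓ} (R : CommutativeRing c ℓ) (a : CommutativeRing.Carrier R)
    (n : ℕ) {s : ℕ} (h : Fin s → Ctx.Loc R n a)
    {m : ℕ} (g : Fin m → Ctx.Loc R n a) (r : Fin m → ℤ) →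
    Ctx.NonZeroDivisor R n a →
    Ctx.AdicallyComplete R n a →
    Ctx.Sub.LocalizesToAll R n a h →
    (∀ i → Ctx.Sub.InFN R n a h (r i) (g i)) →
    Ctx.Sub.IsGrBasis R n a h g r →
    Ctx.Sub.IsNBasis R n a h g × Ctx.IsMBasis R n a (λ i → Ctx.shift R n a (r i) (g i))
lemma3p7 R a n h g r a-nonZeroDivisor (separated , complete) localizes g∈F gr-basis =
  ( (λ i → proj₂ (g∈F i))
  , (λ x x∈N → let (c , x≃) = g-spans separated complete localizes x x∈N in c , ≃⇒≈L x≃)
  , (λ c c≈0 → g-independent separated c (≈L⇒≃ {comb c g} {0L} c≈0)) )
  , ( e∈M
  , (λ x x∈M → let (c , x≃) = e-spans separated complete localizes x x∈M in c , ≃⇒≈L x≃)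
  , (λ c c≈0 → e-independent separated c (≈L⇒≃ {comb c e} {0L} c≈0)) )
  where
  open Ctx R n a
  open Localisation R n a a-nonZeroDivisor using (_≃_; ≈L⇒≃; ≃⇒≈L)
  open Filtered R n a a-nonZeroDivisor h
  open GradedBasis g r g∈F gr-basis
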